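{- Let $p \geq 5$ be a prime and let $C_n = \frac{1}{n+1}\binom{2n}{n}$ denote the $n$th Catalan number. Then for every residue $r \in \mathbb{Z}/p\mathbb{Z}$ the set $\{ n \in \mathbb{N} : C_n \equiv r \pmod p \}$ is infinite. -}

module Defs where

open import Data.Nat using (ℕ; suc; _*_; _/_)
open import Data.Nat.Combinatorics using (_C_)

-- n-th Catalan number C_n = binom(2n, n) / (n + 1)  (the division is exact)
catalan : ℕ → ℕ
catalan n = ((2 * n) C n) / suc n

module Submission where

-- Write central m for (2m choose m); then catalan n * (n + 1) = central n.
-- Lucas's congruence (ap + b choose cp + d) ≡ (a choose c)(b choose d) for
-- digits b, d < p shows that if the base-p digits dᵢ of m all satisfy
-- 2dᵢ < p, then central m ≡ ∏ central dᵢ, and also that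
-- catalan (pm) ≡ central m.  The residues of such products contain
-- central 1 = 2 and are closed under products, hence (the units modulo p
-- having finite order) under inverses.  The identity
-- (e + 1) central (e + 1) = 2 (2e + 1) central e obtains the odd residue
-- 2e + 3 from the smaller residue e + 2, and the factor 2 the even ones, so
-- every nonzero residue is such a product; prepending zero digits makes the
-- argument as large as we like.  The residue 0 is taken at n = pN + t + 3
-- (p = t + 5): doubling n produces a carry, so Lucas gives central n ≡ 0,
-- while p ∤ n + 1.

open import Defs
open import Level using (0ℓ)
open import Function using (id)
open import Data.Nat using (ℕ; zero; suc; _≤_; _<_; _≥_; _+_; _*_; _∸_; _^_; _/_; _%_; NonZero; z≤n; s≤s; nonTrivial⇒n>1)
open import Data.Nat.Properties
open import Data.Nat.Combinatorics using (_C_; nCk+nC[k+1]≡[n+1]C[k+1]; nCk≡nC[n∸k]; nC1≡n; nCn≡1; k>n⇒nCk≡0)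
open import Data.Nat.Divisibility using (_∣_; _∤_; divides; ∣-trans; n∣m*n; m∣m*n; ∣⇒≤; ∣m+n∣m⇒∣n; n∣m⇒m%n≡0; m%n≡0⇒n∣m)
open import Data.Nat.DivMod using (m≡m%n+[m/n]*n; m/n*n≡m; %-distribˡ-+; %-distribˡ-*; %-remove-+ʳ; m%n<n; m<n⇒m%n≡m; [m+kn]%n≡m%n; m*n%n≡0)
open import Data.Nat.Primality using (Prime; prime⇒nonZero; prime⇒nonTrivial; euclidsLemma; composite)
open import Data.Nat.Induction using (<-rec)
open import Data.Nat.ListAction using (product)
open import Data.Nat.ListAction.Properties using (product-++)
open import Data.Nat.Tactic.RingSolver using (solve-∀)
open import Data.Fin using (toℕ; fromℕ<)
open import Data.Fin.Properties using (pigeonhole; toℕ-fromℕ<)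
open import Data.List using (List; []; _∷_; _++_; map; replicate)
open import Data.List.Properties using (map-++)
open import Data.List.Relation.Unary.All using (All; []; _∷_)
open import Data.List.Relation.Unary.All.Properties using (++⁺; replicate⁺)
open import Data.Product using (∃; ∃₂; _×_; _,_)
open import Data.Sum using (inj₁; inj₂; [_,_]′)
open import Data.Empty using (⊥-elim)
open import Relation.Binary.Bundles using (Setoid)
open import Relation.Binary.Structures using (IsEquivalence)
open import Relation.Binary.PropositionalEquality using (_≡_; _≢_; refl; sym; trans; cong; cong₂; subst; module ≡-Reasoning)
import Relation.Binary.Reasoning.Setoid as SetoidReasoning

absorption : ∀ n k → suc k * (suc n C suc k) ≡ suc n * (n C k)
absorption zero zero = refl
absorption zero (suc k)
  rewrite k>n⇒nCk≡0 {1} {suc (suc k)} (s≤s (s≤s z≤n)) | k>n⇒nCk≡0 {0} {suc k} (s≤s z≤n) | *-zeroʳ k = refl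
absorption (suc n) zero rewrite nC1≡n (suc (suc n)) | *-identityʳ n =
  cong (λ m → suc (suc m)) (+-identityʳ n)
absorption (suc n) (suc k) = begin
    suc (suc k) * (suc (suc n) C suc (suc k))
  ≡⟨ cong (suc (suc k) *_) (sym (nCk+nC[k+1]≡[n+1]C[k+1] (suc n) (suc k))) ⟩
    suc (suc k) * (X + Y)
  ≡⟨ *-distribˡ-+ (suc (suc k)) X Y ⟩
    (X + suc k * X) + suc (suc k) * Y
  ≡⟨ cong₂ (λ a b → (X + a) + b) (absorption n k) (absorption n (suc k)) ⟩
    (X + suc n * (n C k)) + suc n * (n C suc k)
  ≡⟨ +-assoc X _ _ ⟩
    X + (suc n * (n C k) + suc n * (n C suc k))
  ≡⟨ cong (X +_) (sym (*-distribˡ-+ (suc n) (n C k) (n C suc k))) ⟩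
    X + suc n * (n C k + n C suc k)
  ≡⟨ cong (λ z → X + suc n * z) (nCk+nC[k+1]≡[n+1]C[k+1] n k) ⟩
    X + suc n * X
  ∎
  where
  open ≡-Reasoning
  X = suc n C suc k
  Y = suc n C suc (suc k)

central : ℕ → ℕ
central m = (2 * m) C m

double-suc : ∀ e → 2 * suc e ≡ suc (suc (2 * e))
double-suc e = *-suc 2 e

half<double : ∀ e → suc e < 2 * suc e
half<double e = m<m+n (suc e) (s≤s z≤n)

middle-symmetry : ∀ e → suc (2 * e) C suc e ≡ suc (2 * e) C e
middle-symmetry e = begin
    suc (2 * e) C suc e       ≡⟨ nCk≡nC[n∸k] (s≤s (m≤m+n e (e + 0))) ⟩
    suc (2 * e) C (2 * e ∸ e) ≡⟨ cong (λ k → suc (2 * e) C k) (trans (m+n∸m≡n e (e + 0)) (+-identityʳ e)) ⟩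
    suc (2 * e) C e           ∎
  where open ≡-Reasoning

central-absorb : ∀ e → suc e * central (suc e) ≡ suc (suc (2 * e)) * (suc (2 * e) C e)
central-absorb e = begin
    suc e * ((2 * suc e) C suc e)           ≡⟨ cong (λ n → suc e * (n C suc e)) (double-suc e) ⟩
    suc e * (suc (suc (2 * e)) C suc e)     ≡⟨ absorption (suc (2 * e)) e ⟩
    suc (suc (2 * e)) * (suc (2 * e) C e)   ∎
  where open ≡-Reasoning

central-suc : ∀ e → suc e * central (suc e) ≡ 2 * (suc (2 * e) * central e)
central-suc e = begin
    suc e * central (suc e)                  ≡⟨ central-absorb e ⟩
    suc (suc (2 * e)) * Z                    ≡⟨ cong (_* Z) (sym (double-suc e)) ⟩
    (2 * suc e) * Z                          ≡⟨ *-assoc 2 (suc e) Z ⟩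
    2 * (suc e * Z)                          ≡⟨ cong (λ z → 2 * (suc e * z)) (sym (middle-symmetry e)) ⟩
    2 * (suc e * (suc (2 * e) C suc e))      ≡⟨ cong (2 *_) (absorption (2 * e) e) ⟩
    2 * (suc (2 * e) * central e)            ∎
  where
  open ≡-Reasoning
  Z = suc (2 * e) C e

central-neighbour : ∀ n → n * central n ≡ suc n * ((2 * n) C suc n)
central-neighbour zero = refl
central-neighbour (suc e) = begin
    suc e * central (suc e)                           ≡⟨ central-absorb e ⟩
    suc (suc (2 * e)) * (suc (2 * e) C e)             ≡⟨ cong (suc (suc (2 * e)) *_) (sym (middle-symmetry e)) ⟩
    suc (suc (2 * e)) * (suc (2 * e) C suc e)         ≡⟨ sym (absorption (suc (2 * e)) (suc e)) ⟩
    suc (suc e) * (suc (suc (2 * e)) C suc (suc e))   ≡⟨ cong (λ n → suc (suc e) * (n C suc (suc e))) (sym (double-suc e)) ⟩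
    suc (suc e) * ((2 * suc e) C suc (suc e))         ∎
  where open ≡-Reasoning

-- n + 1 divides central n, the quotient being central n − (2n choose n + 1).
suc∣central : ∀ n → suc n ∣ central n
suc∣central n = divides (X ∸ Y) (sym (begin
    (X ∸ Y) * suc n             ≡⟨ *-distribʳ-∸ (suc n) X Y ⟩
    X * suc n ∸ Y * suc n       ≡⟨ cong₂ _∸_ (*-comm X (suc n)) (*-comm Y (suc n)) ⟩
    suc n * X ∸ suc n * Y       ≡⟨ cong (suc n * X ∸_) (sym (central-neighbour n)) ⟩
    (X + n * X) ∸ n * X         ≡⟨ m+n∸n≡m X (n * X) ⟩
    X                           ∎))
  where
  open ≡-Reasoning
  X = central n
  Y = (2 * n) C suc n

catalan-spec : ∀ n → catalan n * suc n ≡ central n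
catalan-spec n = m/n*n≡m (suc∣central n)

data Halving : ℕ → Set where
  even : ∀ e → Halving (2 * e)
  odd  : ∀ e → Halving (suc (2 * e))

halve : ∀ n → Halving n
halve zero = even 0
halve (suc n) with halve n
... | even e = odd e
... | odd e  = subst Halving (double-suc e) (even (suc e))

-- Congruence modulo a nonzero modulus p.  It is a record, rather than the
-- bare equation of remainders, so that its two sides can be inferred.
module Congruence (p : ℕ) .{{_ : NonZero p}} where

  infix 4 _≈_
  record _≈_ (x y : ℕ) : Set where
    constructor same-remainder
    field remainders : x % p ≡ y % p

  ≈-isEquivalence : IsEquivalence _≈_
  ≈-isEquivalence = record
    { refl  = same-remainder refl
    ; sym   = λ (same-remainder x≈y) → same-remainder (sym x≈y)
    ; trans = λ (same-remainder x≈y) (same-remainder y≈z) → same-remainder (trans x≈y y≈z)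
    }

  ≈-setoid : Setoid 0ℓ 0ℓ
  ≈-setoid = record { isEquivalence = ≈-isEquivalence }

  open IsEquivalence ≈-isEquivalence public
    using () renaming (refl to ≈-refl; sym to ≈-sym; trans to ≈-trans)
  module ≈-Reasoning = SetoidReasoning ≈-setoid

  +-cong : ∀ {x x′ y y′} → x ≈ x′ → y ≈ y′ → x + y ≈ x′ + y′
  +-cong {x} {x′} {y} {y′} (same-remainder x≈) (same-remainder y≈) = same-remainder (begin
      (x + y) % p               ≡⟨ %-distribˡ-+ x y p ⟩
      (x % p + y % p) % p       ≡⟨ cong₂ (λ u v → (u + v) % p) x≈ y≈ ⟩
      (x′ % p + y′ % p) % p     ≡⟨ sym (%-distribˡ-+ x′ y′ p) ⟩
      (x′ + y′) % p             ∎)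
    where open ≡-Reasoning

  *-cong : ∀ {x x′ y y′} → x ≈ x′ → y ≈ y′ → x * y ≈ x′ * y′
  *-cong {x} {x′} {y} {y′} (same-remainder x≈) (same-remainder y≈) = same-remainder (begin
      (x * y) % p               ≡⟨ %-distribˡ-* x y p ⟩
      (x % p * (y % p)) % p     ≡⟨ cong₂ (λ u v → (u * v) % p) x≈ y≈ ⟩
      (x′ % p * (y′ % p)) % p   ≡⟨ sym (%-distribˡ-* x′ y′ p) ⟩
      (x′ * y′) % p             ∎)
    where open ≡-Reasoning

  *-congˡ : ∀ x {y y′} → y ≈ y′ → x * y ≈ x * y′
  *-congˡ x = *-cong (≈-refl {x})

  *-congʳ : ∀ y {x x′} → x ≈ x′ → x * y ≈ x′ * y
  *-congʳ y x≈x′ = *-cong x≈x′ (≈-refl {y})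

  ∣⇒≈0 : ∀ {x} → p ∣ x → x ≈ 0
  ∣⇒≈0 {x} p∣x = same-remainder (trans (n∣m⇒m%n≡0 x p p∣x) (sym (m*n%n≡0 0 p)))

  ≈0⇒∣ : ∀ {x} → x ≈ 0 → p ∣ x
  ≈0⇒∣ {x} (same-remainder x≈0) = m%n≡0⇒n∣m x p (trans x≈0 (m*n%n≡0 0 p))

  ≈⇒∣∸ : ∀ {x y} → x ≈ y → p ∣ y ∸ x
  ≈⇒∣∸ {x} {y} (same-remainder x≈y) = divides (y / p ∸ x / p) (begin
      y ∸ x                                      ≡⟨ cong₂ _∸_ (m≡m%n+[m/n]*n y p) (m≡m%n+[m/n]*n x p) ⟩
      (y % p + y / p * p) ∸ (x % p + x / p * p)  ≡⟨ cong (λ s → (y % p + y / p * p) ∸ (s + x / p * p)) x≈y ⟩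
      (y % p + y / p * p) ∸ (y % p + x / p * p)  ≡⟨ [m+n]∸[m+o]≡n∸o (y % p) _ _ ⟩
      y / p * p ∸ x / p * p                      ≡⟨ sym (*-distribʳ-∸ p (y / p) (x / p)) ⟩
      (y / p ∸ x / p) * p                        ∎)
    where open ≡-Reasoning

  ∣∸⇒≈ : ∀ {x y} → x ≤ y → p ∣ y ∸ x → x ≈ y
  ∣∸⇒≈ {x} {y} x≤y p∣y∸x = same-remainder (begin
      x % p              ≡⟨ sym (%-remove-+ʳ x p∣y∸x) ⟩
      (x + (y ∸ x)) % p  ≡⟨ cong (_% p) (m+[n∸m]≡n x≤y) ⟩
      y % p              ∎)
    where open ≡-Reasoning

  quotient-form : ∀ {x r} → x ≈ r → r < p → x ≡ r + (x / p) * p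
  quotient-form {x} (same-remainder x≈r) r<p =
    trans (m≡m%n+[m/n]*n x p) (cong (_+ (x / p) * p) (trans x≈r (m<n⇒m%n≡m r<p)))

module Units (p : ℕ) (p-prime : Prime p) where

  private instance
    p≢0 : NonZero p
    p≢0 = prime⇒nonZero p-prime

  open Congruence p

  1<p : 1 < p
  1<p = nonTrivial⇒n>1 p {{prime⇒nonTrivial p-prime}}

  ∤-small : ∀ {x} → 0 < x → x < p → p ∤ x
  ∤-small {suc x} _ x<p p∣x = <⇒≱ x<p (∣⇒≤ p∣x)

  ∤-* : ∀ {x y} → p ∤ x → p ∤ y → p ∤ x * y
  ∤-* {x} {y} p∤x p∤y p∣xy with euclidsLemma x y p-prime p∣xy
  ... | inj₁ p∣x = p∤x p∣x
  ... | inj₂ p∣y = p∤y p∣y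

  ∤-^ : ∀ {u} k → p ∤ u → p ∤ u ^ k
  ∤-^ zero    p∤u = ∤-small (s≤s z≤n) 1<p
  ∤-^ (suc k) p∤u = ∤-* p∤u (∤-^ k p∤u)

  -- Multiplication by a unit is injective modulo p: for a ≤ b,
  -- p ∣ u (b − a) forces p ∣ b − a; the case b ≤ a follows by symmetry.
  cancel-≤ : ∀ {u a b} → p ∤ u → u * a ≈ u * b → a ≤ b → a ≈ b
  cancel-≤ {u} {a} {b} p∤u ua≈ub a≤b
    with euclidsLemma u (b ∸ a) p-prime (subst (p ∣_) (sym (*-distribˡ-∸ u b a)) (≈⇒∣∸ ua≈ub))
  ... | inj₁ p∣u   = ⊥-elim (p∤u p∣u)
  ... | inj₂ p∣b∸a = ∣∸⇒≈ a≤b p∣b∸a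

  cancel : ∀ {u a b} → p ∤ u → u * a ≈ u * b → a ≈ b
  cancel {u} {a} {b} p∤u ua≈ub with ≤-total a b
  ... | inj₁ a≤b = cancel-≤ p∤u ua≈ub a≤b
  ... | inj₂ b≤a = ≈-sym (cancel-≤ p∤u (≈-sym ua≈ub) b≤a)

  -- Pigeonhole: among u⁰, …, uᵖ two powers agree modulo p.
  powers-repeat : ∀ u → ∃₂ λ i j → i < j × u ^ i ≈ u ^ j
  powers-repeat u with pigeonhole (n<1+n p) (λ i → fromℕ< (m%n<n (u ^ toℕ i) p))
  ... | i , j , i<j , same = toℕ i , toℕ j , i<j , same-remainder (begin
      u ^ toℕ i % p                            ≡⟨ sym (toℕ-fromℕ< (m%n<n (u ^ toℕ i) p)) ⟩
      toℕ (fromℕ< (m%n<n (u ^ toℕ i) p))       ≡⟨ cong toℕ same ⟩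
      toℕ (fromℕ< (m%n<n (u ^ toℕ j) p))       ≡⟨ toℕ-fromℕ< (m%n<n (u ^ toℕ j) p) ⟩
      u ^ toℕ j % p                            ∎)
    where open ≡-Reasoning

  -- Every unit has finite order: cancelling uⁱ from uⁱ ≡ uʲ gives uʲ⁻ⁱ ≡ 1.
  power-one : ∀ {u} → p ∤ u → ∃ λ k → u ^ suc k ≈ 1
  power-one {u} p∤u with powers-repeat u
  ... | i , j , i<j , uⁱ≈uʲ = k , ≈-sym (cancel (∤-^ i p∤u) (begin
      u ^ i * 1            ≡⟨ *-identityʳ (u ^ i) ⟩
      u ^ i                ≈⟨ uⁱ≈uʲ ⟩
      u ^ j                ≡⟨ cong (u ^_) (sym i+[k+1]≡j) ⟩
      u ^ (i + suc k)      ≡⟨ ^-distribˡ-+-* u i (suc k) ⟩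
      u ^ i * u ^ suc k    ∎))
    where
    open ≈-Reasoning
    k : ℕ
    k = j ∸ suc i
    i+[k+1]≡j : i + suc k ≡ j
    i+[k+1]≡j = trans (+-suc i k) (m+[n∸m]≡n i<j)

  -- The binomial coefficients in the rows n < p are units, by absorption
  -- (k + 1)(n+1 choose k+1) = (n + 1)(n choose k) and induction.
  ∤-binomial : ∀ {n k} → k ≤ n → n < p → p ∤ n C k
  ∤-binomial {n}     {zero}  _         _   = ∤-small (s≤s z≤n) 1<p
  ∤-binomial {suc n} {suc k} (s≤s k≤n) n<p p∣[n+1]C[k+1] =
    ∤-* (∤-small (s≤s z≤n) n<p) (∤-binomial k≤n (<-trans (n<1+n n) n<p))
        (subst (p ∣_) (absorption n k) (∣-trans p∣[n+1]C[k+1] (n∣m*n (suc k))))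

-- Lucas's congruence for one base-p digit.  The prime is written p = q + 1,
-- q being the digit that appears in borrows.
module Lucas (q : ℕ) (p-prime : Prime (suc q)) where

  p : ℕ
  p = suc q

  open Congruence p
  open Units p p-prime using (∤-small)
  open ≈-Reasoning

  -- p divides (p choose j) for 0 < j < p, as it divides j (p choose j) = p (q choose j − 1).
  p∣pCj : ∀ j → suc j < p → p ∣ p C suc j
  p∣pCj j j<p with euclidsLemma (suc j) (p C suc j) p-prime
                     (divides (q C j) (trans (absorption q j) (*-comm p (q C j))))
  ... | inj₁ p∣j   = ⊥-elim (∤-small (s≤s z≤n) j<p p∣j)
  ... | inj₂ p∣pCj = p∣pCj

  LucasAt : ℕ → Set
  LucasAt n = ∀ k a b c d → b < p → d < p → n ≡ a * p + b → k ≡ c * p + d →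
              n C k ≈ (a C c) * (b C d)

  pascal-≈ : ∀ m k {x y} → m C k ≈ x → m C suc k ≈ y → suc m C suc k ≈ x + y
  pascal-≈ m k {x} {y} x≈ y≈ = begin
      suc m C suc k         ≡⟨ sym (nCk+nC[k+1]≡[n+1]C[k+1] m k) ⟩
      m C k + m C suc k     ≈⟨ +-cong x≈ y≈ ⟩
      x + y                 ∎

  pascal-scaled : ∀ x n k → x * (n C k) + x * (n C suc k) ≡ x * (suc n C suc k)
  pascal-scaled x n k = trans (sym (*-distribˡ-+ x (n C k) (n C suc k)))
                              (cong (x *_) (nCk+nC[k+1]≡[n+1]C[k+1] n k))

  -- Subtracting one from a base-p expansion: the last digit decreases, or it
  -- is 0, becomes q, and the next digit decreases.
  lower-digit : ∀ {m} a b → suc m ≡ a * p + suc b → m ≡ a * p + b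
  lower-digit a b eq = suc-injective (trans eq (+-suc (a * p) b))

  borrow : ∀ a → suc (a * p + q) ≡ suc a * p + 0
  borrow a = sym (trans (+-identityʳ (suc a * p)) (cong suc (+-comm q (a * p))))

  lower-borrow : ∀ {m} a → suc m ≡ suc a * p + 0 → m ≡ a * p + q
  lower-borrow a eq = suc-injective (trans eq (sym (borrow a)))

  q<p : q < p
  q<p = n<1+n q

  -- The induction step from row m to row m + 1, in four cases according to
  -- whether the last digits of the top and bottom entries are zero.
  module Step {m : ℕ} (ih : LucasAt m) where

    digits : ∀ a b c d → suc b < p → suc d < p → suc m ≡ a * p + suc b →
             suc m C (c * p + suc d) ≈ (a C c) * (suc b C suc d)
    digits a b c d b<p d<p eq = begin
        suc m C (c * p + suc d)                       ≡⟨ cong (suc m C_) (+-suc (c * p) d) ⟩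
        suc m C suc (c * p + d)                       ≈⟨ pascal-≈ m (c * p + d) (ih _ a b c d b′<p d′<p m≡ refl)
                                                          (ih _ a b c (suc d) b′<p d<p m≡ (sym (+-suc (c * p) d))) ⟩
        (a C c) * (b C d) + (a C c) * (b C suc d)     ≡⟨ pascal-scaled (a C c) b d ⟩
        (a C c) * (suc b C suc d)                     ∎
      where
      m≡ = lower-digit a b eq
      b′<p = <-trans (n<1+n b) b<p
      d′<p = <-trans (n<1+n d) d<p

    carry : ∀ a c d → suc d < p → suc m ≡ suc a * p + 0 →
            suc m C (c * p + suc d) ≈ (suc a C c) * (0 C suc d)
    carry a c d d<p eq = begin
        suc m C (c * p + suc d)                       ≡⟨ cong (suc m C_) (+-suc (c * p) d) ⟩
        suc m C suc (c * p + d)                       ≈⟨ pascal-≈ m (c * p + d) (ih _ a q c d q<p d′<p m≡ refl)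
                                                          (ih _ a q c (suc d) q<p d<p m≡ (sym (+-suc (c * p) d))) ⟩
        (a C c) * (q C d) + (a C c) * (q C suc d)     ≡⟨ pascal-scaled (a C c) q d ⟩
        (a C c) * (p C suc d)                         ≈⟨ ∣⇒≈0 (∣-trans (p∣pCj d d<p) (n∣m*n (a C c))) ⟩
        0                                             ≡⟨ sym (*-zeroʳ (suc a C c)) ⟩
        (suc a C c) * (0 C suc d)                     ∎
      where
      m≡ = lower-borrow a eq
      d′<p = <-trans (n<1+n d) d<p

    borrow-k : ∀ a b c → suc b < p → suc m ≡ a * p + suc b →
               suc m C (suc c * p + 0) ≈ (a C suc c) * (suc b C 0)
    borrow-k a b c b<p eq = begin
        suc m C (suc c * p + 0)                       ≡⟨ cong (suc m C_) (sym (borrow c)) ⟩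
        suc m C suc (c * p + q)                       ≈⟨ pascal-≈ m (c * p + q) (ih _ a b c q b′<p q<p m≡ refl)
                                                          (ih _ a b (suc c) 0 b′<p (s≤s z≤n) m≡ (borrow c)) ⟩
        (a C c) * (b C q) + (a C suc c) * 1           ≡⟨ cong (λ z → (a C c) * z + (a C suc c) * 1) (k>n⇒nCk≡0 (≤-pred b<p)) ⟩
        (a C c) * 0 + (a C suc c) * 1                 ≡⟨ cong (_+ (a C suc c) * 1) (*-zeroʳ (a C c)) ⟩
        (a C suc c) * 1                               ∎
      where
      m≡ = lower-digit a b eq
      b′<p = <-trans (n<1+n b) b<p

    carry-borrow : ∀ a c → suc m ≡ suc a * p + 0 →
                   suc m C (suc c * p + 0) ≈ (suc a C suc c) * (0 C 0)
    carry-borrow a c eq = begin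
        suc m C (suc c * p + 0)                       ≡⟨ cong (suc m C_) (sym (borrow c)) ⟩
        suc m C suc (c * p + q)                       ≈⟨ pascal-≈ m (c * p + q) (ih _ a q c q q<p q<p m≡ refl)
                                                          (ih _ a q (suc c) 0 q<p (s≤s z≤n) m≡ (borrow c)) ⟩
        (a C c) * (q C q) + (a C suc c) * 1           ≡⟨ cong (λ z → (a C c) * z + (a C suc c) * 1) (nCn≡1 q) ⟩
        (a C c) * 1 + (a C suc c) * 1                 ≡⟨ sym (*-distribʳ-+ 1 (a C c) (a C suc c)) ⟩
        (a C c + a C suc c) * 1                       ≡⟨ cong (_* 1) (nCk+nC[k+1]≡[n+1]C[k+1] a c) ⟩
        (suc a C suc c) * 1                           ∎
      where m≡ = lower-borrow a eq

  lucas : ∀ n → LucasAt n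
  lucas zero    k a       b       zero    zero    _   _   _  refl = ≈-refl
  lucas zero    k zero    zero    (suc c) d       _   _   _  refl = ≈-refl
  lucas zero    k zero    zero    zero    (suc d) _   _   _  refl = ≈-refl
  lucas zero    k zero    (suc b) c       d       _   _   () _
  lucas zero    k (suc a) b       c       d       _   _   () _
  lucas (suc m) k a       b       zero    zero    _   _   _  refl = ≈-refl
  lucas (suc m) k a       (suc b) c       (suc d) b<p d<p eq refl = Step.digits (lucas m) a b c d b<p d<p eq
  lucas (suc m) k (suc a) zero    c       (suc d) _   d<p eq refl = Step.carry (lucas m) a c d d<p eq
  lucas (suc m) k a       (suc b) (suc c) zero    b<p _   eq refl = Step.borrow-k (lucas m) a b c b<p eq
  lucas (suc m) k (suc a) zero    (suc c) zero    _   _   eq refl = Step.carry-borrow (lucas m) a c eq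
  lucas (suc m) k zero    zero    c       d       _   _   () _

module CatalanResidues (t : ℕ) (p-prime : Prime (5 + t)) where

  p : ℕ
  p = 5 + t

  open Congruence p
  open Units p p-prime
  open Lucas (4 + t) p-prime using (lucas)
  open ≈-Reasoning

  2<p : 2 < p
  2<p = s≤s (s≤s (s≤s z≤n))

  2*e≢p : ∀ e → 2 * e ≢ p
  2*e≢p e 2e≡p = Prime.notComposite p-prime (composite {2} 2<p (divides e (trans (sym 2e≡p) (*-comm 2 e))))

  -- A digit d is admissible when 2d < p, so that doubling it does not carry.
  Admissible : ℕ → Set
  Admissible d = 2 * d < p

  -- The number with base-p digits ds, least significant first.
  value : List ℕ → ℕ
  value []       = 0
  value (d ∷ ds) = d + p * value ds

  centralProduct : List ℕ → ℕ
  centralProduct ds = product (map central ds)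

  centralProduct-++ : ∀ xs ys → centralProduct (xs ++ ys) ≡ centralProduct xs * centralProduct ys
  centralProduct-++ xs ys = trans (cong product (map-++ central xs ys)) (product-++ (map central xs) (map central ys))

  centralProduct-replicate : ∀ n d → centralProduct (replicate n d) ≡ central d ^ n
  centralProduct-replicate zero    d = refl
  centralProduct-replicate (suc n) d = cong (central d *_) (centralProduct-replicate n d)

  central-digit : ∀ d m → Admissible d → central (d + p * m) ≈ central m * central d
  central-digit d m 2d<p =
    lucas (2 * (d + p * m)) (d + p * m) (2 * m) (2 * d) m d 2d<p (≤-<-trans (m≤n*m d 2) 2d<p)
          (double-expansion d p m) (expansion d p m)
    where
    double-expansion : ∀ d p m → 2 * (d + p * m) ≡ 2 * m * p + 2 * d
    double-expansion = solve-∀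
    expansion : ∀ d p m → d + p * m ≡ m * p + d
    expansion = solve-∀

  central-value : ∀ {ds} → All Admissible ds → central (value ds) ≈ centralProduct ds
  central-value [] = ≈-refl
  central-value {d ∷ ds} (d-adm ∷ ds-adm) = begin
      central (d + p * value ds)       ≈⟨ central-digit d (value ds) d-adm ⟩
      central (value ds) * central d   ≈⟨ *-congʳ (central d) (central-value ds-adm) ⟩
      centralProduct ds * central d    ≡⟨ *-comm (centralProduct ds) (central d) ⟩
      centralProduct (d ∷ ds)          ∎

  -- catalan (pm) ≡ central m: central (pm) ≡ central m · central 0 and pm + 1 ≡ 1.
  catalan-multiple : ∀ m → catalan (p * m) ≈ central m
  catalan-multiple m = begin
      catalan n              ≡⟨ sym (*-identityʳ (catalan n)) ⟩
      catalan n * 1          ≈⟨ *-congˡ (catalan n) (≈-sym n+1≈1) ⟩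
      catalan n * suc n      ≡⟨ catalan-spec n ⟩
      central n              ≈⟨ lucas (2 * n) n (2 * m) 0 m 0 (s≤s z≤n) (s≤s z≤n) (double-multiple p m) (multiple p m) ⟩
      central m * 1          ≡⟨ *-identityʳ (central m) ⟩
      central m              ∎
    where
    n = p * m
    n+1≈1 : suc n ≈ 1
    n+1≈1 = same-remainder (trans (cong (λ k → suc k % p) (*-comm p m)) ([m+kn]%n≡m%n 1 m p))
    double-multiple : ∀ p m → 2 * (p * m) ≡ 2 * m * p + 0
    double-multiple = solve-∀
    multiple : ∀ p m → p * m ≡ m * p + 0
    multiple = solve-∀

  Representable : ℕ → Set
  Representable x = ∃ λ ds → All Admissible ds × centralProduct ds ≈ x

  rep-≈ : ∀ {x y} → x ≈ y → Representable x → Representable y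
  rep-≈ x≈y (ds , ds-adm , ∏≈x) = ds , ds-adm , ≈-trans ∏≈x x≈y

  rep-* : ∀ {x y} → Representable x → Representable y → Representable (x * y)
  rep-* {x} {y} (ds , ds-adm , ∏ds≈x) (es , es-adm , ∏es≈y) =
    ds ++ es , ++⁺ ds-adm es-adm , (begin
      centralProduct (ds ++ es)             ≡⟨ centralProduct-++ ds es ⟩
      centralProduct ds * centralProduct es ≈⟨ *-cong ∏ds≈x ∏es≈y ⟩
      x * y                                 ∎)

  rep-1 : Representable 1
  rep-1 = [] , [] , ≈-refl

  rep-central : ∀ d → Admissible d → Representable (central d)
  rep-central d d-adm = d ∷ [] , d-adm ∷ [] , same-remainder (cong (_% p) (*-identityʳ (central d)))

  rep-2 : Representable 2
  rep-2 = rep-central 1 2<p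

  rep-^ : ∀ {x} k → Representable x → Representable (x ^ k)
  rep-^ zero    _   = rep-1
  rep-^ (suc k) rep = rep-* rep (rep-^ k rep)

  -- The representable units are closed under inverses: x⁻¹ is a power of x.
  rep-inverse : ∀ {x} → p ∤ x → Representable x → ∃ λ y → Representable y × x * y ≈ 1
  rep-inverse {x} p∤x rep = invert (power-one p∤x)
    where
    invert : (∃ λ k → x ^ suc k ≈ 1) → ∃ λ y → Representable y × x * y ≈ 1
    invert (k , xᵏ⁺¹≈1) = x ^ k , rep-^ k rep , xᵏ⁺¹≈1

  -- If 2e + 1 < p then e + 1 is admissible, as 2(e + 1) ≤ p and p is odd.
  odd-admissible : ∀ e → suc (2 * e) < p → Admissible (suc e)
  odd-admissible e 2e+1<p = ≤∧≢⇒< (subst (_≤ p) (sym (double-suc e)) 2e+1<p) (2*e≢p (suc e))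

  -- The odd residue c = 2e + 3 < p from the smaller residue a = e + 2:
  -- a · central a = 2c · central (e + 1), where x = 2 · central (e + 1) is
  -- a representable unit.
  rep-odd : ∀ e → suc (2 * suc e) < p → Representable (suc (suc e)) → Representable (suc (2 * suc e))
  rep-odd e c<p rep-a = divide (rep-inverse p∤x rep-x)
    where
    a c x : ℕ
    a = suc (suc e)
    c = suc (2 * suc e)
    x = 2 * central (suc e)
    a-adm : Admissible a
    a-adm = odd-admissible (suc e) c<p
    e+1-adm : Admissible (suc e)
    e+1-adm = <-trans (*-monoʳ-< 2 (n<1+n (suc e))) a-adm
    p∤x : p ∤ x
    p∤x = ∤-* (∤-small (s≤s z≤n) 2<p) (∤-binomial {2 * suc e} {suc e} (m≤m+n (suc e) (suc e + 0)) e+1-adm)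
    rep-x : Representable x
    rep-x = rep-* rep-2 (rep-central (suc e) e+1-adm)
    regroup : ∀ c B y → (2 * (c * B)) * y ≡ c * ((2 * B) * y)
    regroup = solve-∀
    divide : (∃ λ y → Representable y × x * y ≈ 1) → Representable c
    divide (y , rep-y , xy≈1) = rep-≈ (begin
      (central a * a) * y                  ≡⟨ cong (_* y) (trans (*-comm (central a) a) (central-suc (suc e))) ⟩
      (2 * (c * central (suc e))) * y      ≡⟨ regroup c (central (suc e)) y ⟩
      c * (x * y)                          ≈⟨ *-congˡ c xy≈1 ⟩
      c * 1                                ≡⟨ *-identityʳ c ⟩
      c                                    ∎) (rep-* (rep-* (rep-central a a-adm) rep-a) rep-y)

  -- Every nonzero residue is representable, by strong induction: an even
  -- residue is 2 times a smaller one, an odd one is handled by rep-odd.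
  representable : ∀ c → 0 < c → c < p → Representable c
  representable = <-rec (λ c → 0 < c → c < p → Representable c) (λ c rec → by-parity (halve c) rec)
    where
    by-parity : ∀ {c} → Halving c → (∀ {c′} → c′ < c → 0 < c′ → c′ < p → Representable c′) →
                0 < c → c < p → Representable c
    by-parity (even zero)    rec ()
    by-parity (even (suc e)) rec _ c<p =
      rep-* rep-2 (rec (half<double e) (s≤s z≤n) (<-trans (half<double e) c<p))
    by-parity (odd zero)     rec _ _   = rep-1
    by-parity (odd (suc e))  rec _ c<p =
      rep-odd e c<p (rec (s≤s (half<double e)) (s≤s z≤n) (<-trans (s≤s (half<double e)) c<p))

  -- Prepending N zero digits to a positive number makes it exceed N: each
  -- zero digit turns a value v ≥ 1 into p v = v + (p − 1) v ≥ v + 1.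
  value-padding : ∀ N ys → 1 ≤ value ys → N < value (replicate N 0 ++ ys)
  value-padding zero    ys 1≤v = 1≤v
  value-padding (suc N) ys 1≤v =
    subst (_≤ v + q * v) (+-comm (suc N) 1) (+-mono-≤ N<v (≤-trans (≤-trans (s≤s z≤n) N<v) (m≤n*m v q)))
    where
    q v : ℕ
    q = 4 + t
    v = value (replicate N 0 ++ ys)
    N<v : N < v
    N<v = value-padding N ys 1≤v

  -- A representable x is ≡ central m for arbitrarily large m: put the digits
  -- of 2ᵏ⁺¹ ≡ 1 before those of x, so that the value is positive, and prepend
  -- N zero digits (central 0 = 1).
  central-large : ∀ {x} → Representable x → ∀ N → ∃ λ m → N ≤ m × central m ≈ x
  central-large {x} (ds , ds-adm , ∏ds≈x) N = pad (power-one (∤-small (s≤s z≤n) 2<p))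
    where
    pad : (∃ λ k → 2 ^ suc k ≈ 1) → ∃ λ m → N ≤ m × central m ≈ x
    pad (k , 2ᵏ⁺¹≈1) = value zs , <⇒≤ (value-padding N ys (s≤s z≤n)) , (begin
        central (value zs)
      ≈⟨ central-value zs-adm ⟩
        centralProduct (replicate N 0 ++ ys)
      ≡⟨ centralProduct-++ (replicate N 0) ys ⟩
        centralProduct (replicate N 0) * centralProduct (replicate (suc k) 1 ++ ds)
      ≡⟨ cong₂ _*_ (centralProduct-replicate N 0) (centralProduct-++ (replicate (suc k) 1) ds) ⟩
        1 ^ N * (centralProduct (replicate (suc k) 1) * centralProduct ds)
      ≡⟨ cong (λ z → 1 ^ N * (z * centralProduct ds)) (centralProduct-replicate (suc k) 1) ⟩
        1 ^ N * (2 ^ suc k * centralProduct ds)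
      ≡⟨ cong (_* (2 ^ suc k * centralProduct ds)) (^-zeroˡ N) ⟩
        1 * (2 ^ suc k * centralProduct ds)
      ≈⟨ *-congˡ 1 (*-cong 2ᵏ⁺¹≈1 ∏ds≈x) ⟩
        1 * (1 * x)
      ≡⟨ trans (*-identityˡ (1 * x)) (*-identityˡ x) ⟩
        x
      ∎)
      where
      ys zs : List ℕ
      ys = replicate (suc k) 1 ++ ds
      zs = replicate N 0 ++ ys
      zs-adm : All Admissible zs
      zs-adm = ++⁺ (replicate⁺ N (s≤s z≤n)) (++⁺ (replicate⁺ (suc k) 2<p) ds-adm)

  -- Every nonzero residue r: catalan (pm) ≡ central m ≡ r for large m.
  nonzero-residue : ∀ r → 0 < r → r < p → ∀ N → ∃ λ n → N ≤ n × catalan n ≈ r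
  nonzero-residue r 0<r r<p N = attain (central-large (representable r 0<r r<p) N)
    where
    attain : (∃ λ m → N ≤ m × central m ≈ r) → ∃ λ n → N ≤ n × catalan n ≈ r
    attain (m , N≤m , central-m≈r) = p * m , ≤-trans N≤m (m≤n*m m p) , ≈-trans (catalan-multiple m) central-m≈r

  -- The residue 0 at n = pN + (t + 3): as 2n = (2N + 1)p + (t + 1) with
  -- t + 1 < t + 3, Lucas gives central n ≡ (2N+1 choose N)(t+1 choose t+3) = 0;
  -- since n + 1 = pN + (t + 4) is prime to p, p divides catalan n.
  zero-residue : ∀ N → ∃ λ n → N ≤ n × catalan n ≈ 0
  zero-residue N = n , ≤-trans (m≤n*m N p) (m≤m+n (p * N) b) , ∣⇒≈0 p∣catalan
    where
    b n : ℕ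
    b = 3 + t
    n = p * N + b
    double-carry : ∀ t N → 2 * ((5 + t) * N + (3 + t)) ≡ (1 + 2 * N) * (5 + t) + (1 + t)
    double-carry = solve-∀
    expansion : ∀ t N → (5 + t) * N + (3 + t) ≡ N * (5 + t) + (3 + t)
    expansion = solve-∀
    central≈0 : central n ≈ 0
    central≈0 = begin
        central n                         ≈⟨ lucas (2 * n) n (suc (2 * N)) (suc t) N b 1+t<p b<p (double-carry t N) (expansion t N) ⟩
        (suc (2 * N) C N) * (suc t C b)   ≡⟨ cong ((suc (2 * N) C N) *_) (k>n⇒nCk≡0 (s≤s (s≤s (n≤1+n t)))) ⟩
        (suc (2 * N) C N) * 0             ≡⟨ *-zeroʳ (suc (2 * N) C N) ⟩
        0                                 ∎
      where
      b<p : b < p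
      b<p = s≤s (s≤s (s≤s (s≤s (n≤1+n t))))
      1+t<p : suc t < p
      1+t<p = <-trans (s≤s (s≤s (n≤1+n t))) b<p
    p∤n+1 : p ∤ suc n
    p∤n+1 p∣n+1 = ∤-small (s≤s z≤n) (s≤s ≤-refl) (∣m+n∣m⇒∣n (subst (p ∣_) (sym (+-suc (p * N) b)) p∣n+1) (m∣m*n N))
    p∣catalan : p ∣ catalan n
    p∣catalan = [ id , (λ p∣n+1 → ⊥-elim (p∤n+1 p∣n+1)) ]′
      (euclidsLemma (catalan n) (suc n) p-prime (subst (p ∣_) (sym (catalan-spec n)) (≈0⇒∣ central≈0)))

  catalan-residues : ∀ r → r < p → ∀ N → ∃ λ n → N ≤ n × catalan n ≈ r
  catalan-residues zero    _   = zero-residue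
  catalan-residues (suc r) r<p = nonzero-residue (suc r) (s≤s z≤n) r<p

mainTheorem4 : (p : ℕ) → Prime p → 5 ≤ p →
    (r : ℕ) → r < p →
    ∀ (N : ℕ) → ∃ λ n → n ≥ N × ∃ λ k → catalan n ≡ r + k * p
mainTheorem4 p@(suc (suc (suc (suc (suc t))))) p-prime (s≤s (s≤s (s≤s (s≤s (s≤s _))))) r r<p N =
  quotient (CatalanResidues.catalan-residues t p-prime r r<p N)
  where
  open Congruence p using (_≈_; quotient-form)
  quotient : (∃ λ n → N ≤ n × catalan n ≈ r) → ∃ λ n → n ≥ N × ∃ λ k → catalan n ≡ r + k * p
  quotient (n , N≤n , catalan≈r) = n , N≤n , catalan n / p , quotient-form catalan≈r r<p
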